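{- Let $\mathcal{P}$ and $\mathcal{B}$ be finite sets of atomic program and test symbols. Let $F$ be a set of equations $c_ip_i=c_i$, $1\le i\le k$, where $p_1,\ldots,p_k\in\mathcal{P}$ are distinct and each $c_i$ is a Boolean term. Define $H:\mathrm{Rex}_{\mathcal{P},\mathcal{B}}\to\mathrm{Rex}_{\mathcal{P},\mathcal{B}}$ by $H(r)=r[p_i/\overline{c_i}p_i+c_i]$, the result of substituting $\overline{c_i}p_i+c_i$ for $p_i$ in $r$ for each $i$. Then for any set $E$ of equations between terms, any $s,t\in\mathrm{Rex}_{\mathcal{P},\mathcal{B}}$, and any Kleene algebra with tests $K$, $$K\models E\wedge F\rightarrow s=t \iff K\models H(E)\rightarrow H(s)=H(t),$$ where $H(E)=\{H(r)=H(r') : (r=r')\in E\}$.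
   Context: A Kleene algebra with tests (KAT) is a two-sorted structure $(K,B,+,\cdot,{}^*,\overline{\phantom{x}},0,1)$ where $(K,+,\cdot,{}^*,0,1)$ is a Kleene algebra (an idempotent semiring with partial order $x\le y:\iff x+y=y$ satisfying $1+xx^*\le x^*$, $1+x^*x\le x^*$, $p+qx\le x\rightarrow q^*p\le x$, $p+xq\le x\rightarrow pq^*\le x$) and $B\subseteq K$ with $(B,+,\cdot,\overline{\phantom{x}},0,1)$ a Boolean algebra of tests. $\mathrm{Rex}_{\mathcal{P},\mathcal{B}}$ is the set of KAT terms over atomic programs $\mathcal{P}$ and atomic tests $\mathcal{B}$, where negation may only be applied to Boolean terms (terms built from atomic tests, $0,1,+,\cdot$ and negation). An interpretation into $K$ is a map $I:\mathrm{Rex}_{\mathcal{P},\mathcal{B}}\to K$ respecting all operations and sending atomic tests to tests. For a set of equations $G$, $K\models G\rightarrow s=t$ means: for every interpretation $I$ into $K$ satisfying all equations in $G$, $I(s)=I(t)$; $E\wedge F$ denotes the union of the two sets of equations. -}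

module Defs where

open import Level using (Level; _⊔_) renaming (suc to lsuc)
open import Data.Nat using (ℕ)
open import Data.Fin using (Fin)
open import Data.Fin.Properties using (any?; _≟_)
open import Data.Product using (Σ; ∃; _×_; _,_)
open import Data.Sum using (_⊎_)
open import Relation.Nullary using (yes; no)
open import Relation.Binary.PropositionalEquality using (_≡_)
open import Relation.Binary.Structures using (IsEquivalence)
open import Algebra.Lattice.Bundles using (BooleanAlgebra)

-- K is an idempotent semiring with star axioms stated with the natural
-- order x ≤ y :⇔ x + y ≈ y.  (The stdlib's IsKleeneAlgebra states the
-- induction axioms with ≈ instead of ≤, which is not the standard notion,
-- so we define our own.)  The tests form a Boolean algebra B whose
-- carrier is embedded injectively into K, with +,·,0,1 of B being those
-- of K (B ⊆ K).

record KAT (c ℓ c' ℓ' : Level) : Set (lsuc (c ⊔ ℓ ⊔ c' ⊔ ℓ')) where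
  infixl 6 _+_
  infixl 7 _·_
  infix 8 _⋆
  infix 4 _≈_ _≤_
  field
    Carrier : Set c
    _≈_     : Carrier → Carrier → Set ℓ
    _+_     : Carrier → Carrier → Carrier
    _·_     : Carrier → Carrier → Carrier
    _⋆      : Carrier → Carrier
    0#      : Carrier
    1#      : Carrier
    isEquivalence : IsEquivalence _≈_
    +-cong  : ∀ {x y u v} → x ≈ y → u ≈ v → x + u ≈ y + v
    ·-cong  : ∀ {x y u v} → x ≈ y → u ≈ v → x · u ≈ y · v
    ⋆-cong  : ∀ {x y} → x ≈ y → x ⋆ ≈ y ⋆
    +-assoc : ∀ x y z → (x + y) + z ≈ x + (y + z)
    +-comm  : ∀ x y → x + y ≈ y + x
    +-idem  : ∀ x → x + x ≈ x
    +-identityˡ : ∀ x → 0# + x ≈ x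
    ·-assoc : ∀ x y z → (x · y) · z ≈ x · (y · z)
    ·-identityˡ : ∀ x → 1# · x ≈ x
    ·-identityʳ : ∀ x → x · 1# ≈ x
    distribˡ : ∀ x y z → x · (y + z) ≈ x · y + x · z
    distribʳ : ∀ x y z → (y + z) · x ≈ y · x + z · x
    zeroˡ   : ∀ x → 0# · x ≈ 0#
    zeroʳ   : ∀ x → x · 0# ≈ 0#

  _≤_ : Carrier → Carrier → Set ℓ
  x ≤ y = x + y ≈ y

  field
    star-unfoldʳ : ∀ x → 1# + x · x ⋆ ≤ x ⋆
    star-unfoldˡ : ∀ x → 1# + x ⋆ · x ≤ x ⋆
    star-indˡ    : ∀ p q x → p + q · x ≤ x → q ⋆ · p ≤ x
    star-indʳ    : ∀ p q x → p + x · q ≤ x → p · q ⋆ ≤ x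
    Tests : BooleanAlgebra c' ℓ'

  open BooleanAlgebra Tests using () renaming
    (Carrier to Test; _≈_ to _≈ᵇ_; _∨_ to _∨ᵇ_; _∧_ to _∧ᵇ_; ⊤ to ⊤ᵇ; ⊥ to ⊥ᵇ; ¬_ to ¬ᵇ_)
    public

  field
    ι       : Test → Carrier
    ι-cong  : ∀ {a b} → a ≈ᵇ b → ι a ≈ ι b
    ι-inj   : ∀ {a b} → ι a ≈ ι b → a ≈ᵇ b
    ι-+     : ∀ a b → ι (a ∨ᵇ b) ≈ ι a + ι b
    ι-·     : ∀ a b → ι (a ∧ᵇ b) ≈ ι a · ι b
    ι-0     : ι ⊥ᵇ ≈ 0#
    ι-1     : ι ⊤ᵇ ≈ 1#

data BExp (nB : ℕ) : Set where
  atom : Fin nB → BExp nB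
  𝟘 𝟙  : BExp nB
  _⊕_ _⊗_ : BExp nB → BExp nB → BExp nB
  ‾_ : BExp nB → BExp nB

data Rex (nP nB : ℕ) : Set where
  prog : Fin nP → Rex nP nB
  test : BExp nB → Rex nP nB
  _⊕_ _⊗_ : Rex nP nB → Rex nP nB → Rex nP nB
  _✶ : Rex nP nB → Rex nP nB

-- (0 and 1 are the Boolean terms test 𝟘 and test 𝟙.)

Equation : ℕ → ℕ → Set
Equation nP nB = Rex nP nB × Rex nP nB

EqSet : ℕ → ℕ → Set₁
EqSet nP nB = Equation nP nB → Set

_∧ₑ_ : ∀ {nP nB} → EqSet nP nB → EqSet nP nB → EqSet nP nB
(E ∧ₑ F) e = E e ⊎ F e

module _ {c ℓ c' ℓ'} (K : KAT c ℓ c' ℓ') where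
  open KAT K
  open BooleanAlgebra Tests using (¬_)

  evalB : ∀ {nB} → (Fin nB → Test) → BExp nB → Test
  evalB θ (atom b) = θ b
  evalB θ 𝟘 = ⊥ᵇ
  evalB θ 𝟙 = ⊤ᵇ
  evalB θ (x ⊕ y) = evalB θ x ∨ᵇ evalB θ y
  evalB θ (x ⊗ y) = evalB θ x ∧ᵇ evalB θ y
  evalB θ (‾ x) = ¬ evalB θ x

  eval : ∀ {nP nB} → (Fin nP → Carrier) → (Fin nB → Test) → Rex nP nB → Carrier
  eval σ θ (prog p) = σ p
  eval σ θ (test b) = ι (evalB θ b)
  eval σ θ (x ⊕ y) = eval σ θ x + eval σ θ y
  eval σ θ (x ⊗ y) = eval σ θ x · eval σ θ y
  eval σ θ (x ✶) = eval σ θ x ⋆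

  Satisfies : ∀ {nP nB} → (Fin nP → Carrier) → (Fin nB → Test) → EqSet nP nB → Set ℓ
  Satisfies σ θ G = ∀ r r' → G (r , r') → eval σ θ r ≈ eval σ θ r'

  Models : ∀ {nP nB} → EqSet nP nB → Rex nP nB → Rex nP nB → Set (c ⊔ ℓ ⊔ c')
  Models {nP} {nB} G s t =
    (σ : Fin nP → Carrier) (θ : Fin nB → Test) → Satisfies σ θ G → eval σ θ s ≈ eval σ θ t

substRex : ∀ {nP nB} → (Fin nP → Rex nP nB) → Rex nP nB → Rex nP nB
substRex τ (prog p) = τ p
substRex τ (test b) = test b
substRex τ (x ⊕ y) = substRex τ x ⊕ substRex τ y
substRex τ (x ⊗ y) = substRex τ x ⊗ substRex τ y
substRex τ (x ✶) = substRex τ x ✶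

module _ {nP nB k : ℕ} (p : Fin k → Fin nP) (cs : Fin k → BExp nB) where

  Hatom : Fin nP → Rex nP nB
  Hatom q with any? (λ i → p i ≟ q)
  ... | yes (i , _) = (test (‾ cs i) ⊗ prog q) ⊕ test (cs i)
  ... | no _ = prog q

  H : Rex nP nB → Rex nP nB
  H = substRex Hatom

  HE : EqSet nP nB → EqSet nP nB
  HE E (u , v) = Σ (Equation nP nB) λ { (r , r') → E (r , r') × (u ≡ H r) × (v ≡ H r') }

  Feqs : EqSet nP nB
  Feqs (u , v) = ∃ λ i → (u ≡ test (cs i) ⊗ prog (p i)) × (v ≡ test (cs i))

{-# OPTIONS --safe #-}
-- H sends every interpretation σ to the interpretation σ ∘ H, and this map
-- is a retraction onto the interpretations satisfying F: σ ∘ H always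
-- satisfies F because c (‾c p + c) = c, and it agrees with σ whenever σ
-- satisfies F because ‾c p + c = ‾c p + c p = p.  Quantifying over
-- interpretations on either side of the equivalence therefore amounts to
-- the same thing.
module Submission where

open import Defs
open import Level using (Level)
open import Data.Nat using (ℕ)
open import Data.Fin using (Fin)
open import Data.Fin.Properties using (any?; _≟_)
open import Data.Product using (Σ; _×_; _,_)
open import Data.Sum using (inj₁; inj₂)
open import Data.Empty using (⊥-elim)
open import Function.Definitions using (Injective)
open import Function.Bundles using (_⇔_; mk⇔)
open import Relation.Nullary using (yes; no)
open import Relation.Binary.PropositionalEquality using (_≡_; refl; cong; cong₂)
open import Relation.Binary.Bundles using (Setoid)
open import Relation.Binary.Structures using (IsEquivalence)
open import Algebra.Lattice.Bundles using (BooleanAlgebra)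
import Algebra.Lattice.Properties.BooleanAlgebra as BooleanAlgebraProperties
import Relation.Binary.Reasoning.Setoid as SetoidReasoning

substEqs : ∀ {nP nB} → (Fin nP → Rex nP nB) → EqSet nP nB → EqSet nP nB
substEqs {nP} {nB} τ E (u , v) =
  Σ (Equation nP nB) λ { (r , r') → E (r , r') × (u ≡ substRex τ r) × (v ≡ substRex τ r') }

module _ {c ℓ c' ℓ'} (K : KAT c ℓ c' ℓ') where
  open KAT K
  open BooleanAlgebra Tests using (¬_; ∨-complementˡ; ∧-complementʳ)
  open BooleanAlgebraProperties Tests using (∧-idem)
  open IsEquivalence isEquivalence using () renaming (refl to ≈-refl; sym to ≈-sym)

  setoid : Setoid c ℓ
  setoid = record { isEquivalence = isEquivalence }

  open SetoidReasoning setoid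

  ¬b·x+b·x≈x : ∀ b x → ι (¬ b) · x + ι b · x ≈ x
  ¬b·x+b·x≈x b x = begin
    ι (¬ b) · x + ι b · x  ≈⟨ distribʳ x _ _ ⟨
    (ι (¬ b) + ι b) · x    ≈⟨ ·-cong (ι-+ _ _) ≈-refl ⟨
    ι (¬ b ∨ᵇ b) · x       ≈⟨ ·-cong (ι-cong (∨-complementˡ b)) ≈-refl ⟩
    ι ⊤ᵇ · x               ≈⟨ ·-cong ι-1 ≈-refl ⟩
    1# · x                 ≈⟨ ·-identityˡ x ⟩
    x                      ∎

  b·[¬b·x+b]≈b : ∀ b x → ι b · (ι (¬ b) · x + ι b) ≈ ι b
  b·[¬b·x+b]≈b b x = begin
    ι b · (ι (¬ b) · x + ι b)        ≈⟨ distribˡ _ _ _ ⟩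
    ι b · (ι (¬ b) · x) + ι b · ι b  ≈⟨ +-cong (·-assoc _ _ _) (ι-· b b) ⟨
    (ι b · ι (¬ b)) · x + ι (b ∧ᵇ b) ≈⟨ +-cong (·-cong (≈-sym (ι-· b (¬ b))) ≈-refl) (ι-cong (∧-idem b)) ⟩
    ι (b ∧ᵇ ¬ b) · x + ι b           ≈⟨ +-cong (·-cong (ι-cong (∧-complementʳ b)) ≈-refl) ≈-refl ⟩
    ι ⊥ᵇ · x + ι b                   ≈⟨ +-cong (·-cong ι-0 ≈-refl) ≈-refl ⟩
    0# · x + ι b                     ≈⟨ +-cong (zeroˡ x) ≈-refl ⟩
    0# + ι b                         ≈⟨ +-identityˡ _ ⟩
    ι b                              ∎

  module _ {nP nB : ℕ} where

    evalSubst : (Fin nP → Carrier) → (Fin nB → Test) → (Fin nP → Rex nP nB) → Fin nP → Carrier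
    evalSubst σ θ τ q = eval K σ θ (τ q)

    eval-substRex : ∀ σ θ τ (r : Rex nP nB) → eval K σ θ (substRex τ r) ≡ eval K (evalSubst σ θ τ) θ r
    eval-substRex σ θ τ (prog q) = refl
    eval-substRex σ θ τ (test b) = refl
    eval-substRex σ θ τ (x ⊕ y)  = cong₂ _+_ (eval-substRex σ θ τ x) (eval-substRex σ θ τ y)
    eval-substRex σ θ τ (x ⊗ y)  = cong₂ _·_ (eval-substRex σ θ τ x) (eval-substRex σ θ τ y)
    eval-substRex σ θ τ (x ✶)    = cong _⋆ (eval-substRex σ θ τ x)

    eval-cong : ∀ {σ σ'} θ → (∀ q → σ q ≈ σ' q) → (r : Rex nP nB) → eval K σ θ r ≈ eval K σ' θ r
    eval-cong θ σ≈σ' (prog q) = σ≈σ' q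
    eval-cong θ σ≈σ' (test b) = ≈-refl
    eval-cong θ σ≈σ' (x ⊕ y)  = +-cong (eval-cong θ σ≈σ' x) (eval-cong θ σ≈σ' y)
    eval-cong θ σ≈σ' (x ⊗ y)  = ·-cong (eval-cong θ σ≈σ' x) (eval-cong θ σ≈σ' y)
    eval-cong θ σ≈σ' (x ✶)    = ⋆-cong (eval-cong θ σ≈σ' x)

    module _ (τ : Fin nP → Rex nP nB) (F : EqSet nP nB)
             (τ-satisfies : ∀ σ θ → Satisfies K (evalSubst σ θ τ) θ F)
             (τ-fixes : ∀ σ θ → Satisfies K σ θ F → ∀ q → eval K σ θ (τ q) ≈ σ q)
             where

      eval-substRex-fixes : ∀ σ θ → Satisfies K σ θ F → ∀ r → eval K σ θ (substRex τ r) ≈ eval K σ θ r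
      eval-substRex-fixes σ θ satF r = begin
        eval K σ θ (substRex τ r)     ≡⟨ eval-substRex σ θ τ r ⟩
        eval K (evalSubst σ θ τ) θ r  ≈⟨ eval-cong θ (τ-fixes σ θ satF) r ⟩
        eval K σ θ r                  ∎

      Models-∧-⇒-substRex : ∀ E s t → Models K (E ∧ₑ F) s t → Models K (substEqs τ E) (substRex τ s) (substRex τ t)
      Models-∧-⇒-substRex E s t E∧F⊨s=t σ θ satτE = begin
        eval K σ θ (substRex τ s)  ≡⟨ eval-substRex σ θ τ s ⟩
        eval K σ' θ s              ≈⟨ E∧F⊨s=t σ' θ satE∧F ⟩
        eval K σ' θ t              ≡⟨ eval-substRex σ θ τ t ⟨
        eval K σ θ (substRex τ t)  ∎
        where
          σ' : Fin nP → Carrier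
          σ' = evalSubst σ θ τ
          satE∧F : Satisfies K σ' θ (E ∧ₑ F)
          satE∧F r r' (inj₂ r=r'∈F) = τ-satisfies σ θ r r' r=r'∈F
          satE∧F r r' (inj₁ r=r'∈E) = begin
            eval K σ' θ r               ≡⟨ eval-substRex σ θ τ r ⟨
            eval K σ θ (substRex τ r)   ≈⟨ satτE _ _ ((r , r') , r=r'∈E , refl , refl) ⟩
            eval K σ θ (substRex τ r')  ≡⟨ eval-substRex σ θ τ r' ⟩
            eval K σ' θ r'              ∎

      Models-substRex-⇒-∧ : ∀ E s t → Models K (substEqs τ E) (substRex τ s) (substRex τ t) → Models K (E ∧ₑ F) s t
      Models-substRex-⇒-∧ E s t τE⊨τs=τt σ θ satE∧F = begin
        eval K σ θ s               ≈⟨ fixes s ⟨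
        eval K σ θ (substRex τ s)  ≈⟨ τE⊨τs=τt σ θ satτE ⟩
        eval K σ θ (substRex τ t)  ≈⟨ fixes t ⟩
        eval K σ θ t               ∎
        where
          fixes : ∀ r → eval K σ θ (substRex τ r) ≈ eval K σ θ r
          fixes = eval-substRex-fixes σ θ (λ r r' r=r'∈F → satE∧F r r' (inj₂ r=r'∈F))
          satτE : Satisfies K σ θ (substEqs τ E)
          satτE _ _ ((r , r') , r=r'∈E , refl , refl) = begin
            eval K σ θ (substRex τ r)   ≈⟨ fixes r ⟩
            eval K σ θ r                ≈⟨ satE∧F r r' (inj₁ r=r'∈E) ⟩
            eval K σ θ r'               ≈⟨ fixes r' ⟨
            eval K σ θ (substRex τ r')  ∎

      Models-∧-⇔-substRex : ∀ E s t → Models K (E ∧ₑ F) s t ⇔ Models K (substEqs τ E) (substRex τ s) (substRex τ t)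
      Models-∧-⇔-substRex E s t = mk⇔ (Models-∧-⇒-substRex E s t) (Models-substRex-⇒-∧ E s t)

  module _ {nP nB k : ℕ} (p : Fin k → Fin nP) (cs : Fin k → BExp nB) where

    Hatom-fixes : ∀ σ θ → Satisfies K σ θ (Feqs p cs) → ∀ q → eval K σ θ (Hatom p cs q) ≈ σ q
    Hatom-fixes σ θ satF q with any? (λ i → p i ≟ q)
    ... | no _ = ≈-refl
    ... | yes (i , refl) = begin
      ι (¬ b) · σ (p i) + ι b           ≈⟨ +-cong ≈-refl (satF _ _ (i , refl , refl)) ⟨
      ι (¬ b) · σ (p i) + ι b · σ (p i) ≈⟨ ¬b·x+b·x≈x b (σ (p i)) ⟩
      σ (p i)                           ∎
      where
        b : Test
        b = evalB K θ (cs i)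

    Hatom-satisfies : Injective _≡_ _≡_ p → ∀ σ θ → Satisfies K (evalSubst σ θ (Hatom p cs)) θ (Feqs p cs)
    Hatom-satisfies p-injective σ θ _ _ (i , refl , refl) with any? (λ j → p j ≟ p i)
    ... | no p∉im = ⊥-elim (p∉im (i , refl))
    ... | yes (j , pj≡pi) with p-injective pj≡pi
    ...   | refl = b·[¬b·x+b]≈b (evalB K θ (cs j)) (σ (p j))

corollary14 : ∀ {c ℓ c' ℓ' : Level} (K : KAT c ℓ c' ℓ')
                {nP nB k : ℕ} (p : Fin k → Fin nP) → Injective _≡_ _≡_ p →
                (cs : Fin k → BExp nB) (E : EqSet nP nB) (s t : Rex nP nB) →
                Models K (E ∧ₑ Feqs p cs) s t ⇔ Models K (HE p cs E) (H p cs s) (H p cs t)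
-- HE p cs E unfolds to substEqs (Hatom p cs) E.
corollary14 K p p-injective cs =
  Models-∧-⇔-substRex K (Hatom p cs) (Feqs p cs)
    (Hatom-satisfies K p cs p-injective) (Hatom-fixes K p cs)
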